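{- Let $\mathcal{P}$ be the class of all finite structures $X=(A,S,T)$, with $S,T\subseteq A\times A$ binary relations, such that: (1) the directed graph $(A,S\cup T)$ is a directed forest; (2) $S\cap T=\emptyset$; (3) for every $w\in A$, the set of edges $(v,w)\in S\cup T$ with target $w$ is contained entirely in $S$ or entirely in $T$. Then $\mathcal{P}$ does not have the cofinal amalgamation property.
   Context: A directed graph $(A,R)$ with $R\subseteq A\times A$ is a directed forest if $R$ is antisymmetric (if $(v,w)\in R$ then $(w,v)\notin R$), irreflexive, and the undirected graph on $A$ with edge set $\{\{v,w\}:(v,w)\in R\}$ is acyclic. Embeddings between $\{S,T\}$-structures are injective maps preserving and reflecting both relations. A class $\mathcal{F}$ of finite structures has the cofinal amalgamation property (CAP) if for every $Z\in\mathcal{F}$ there is $Z'\in\mathcal{F}$ containing $Z$ as a substructure such that for all embeddings $f\colon Z'\to X$, $g\colon Z'\to Y$ with $X,Y\in\mathcal{F}$ there exist $W\in\mathcal{F}$ and embeddings $f'\colon X\to W$, $g'\colon Y\to W$ with $f'\circ f=g'\circ g$. -}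

module Defs where

open import Data.Nat using (ℕ; suc)
open import Data.Fin using (Fin; zero; suc; inject₁; fromℕ)
open import Data.Bool using (Bool; true; false; _∨_)
open import Data.Product using (Σ; Σ-syntax; _×_)
open import Data.Sum using (_⊎_)
open import Relation.Nullary using (¬_)
open import Relation.Binary.PropositionalEquality using (_≡_)
open import Function.Definitions using (Injective)

record Str : Set where
  field
    size : ℕ
    S    : Fin size → Fin size → Bool
    T    : Fin size → Fin size → Bool
open Str public

record Emb (X Y : Str) : Set where
  field
    fun     : Fin (size X) → Fin (size Y)
    inj     : Injective _≡_ _≡_ fun
    pres-S  : ∀ a b → S Y (fun a) (fun b) ≡ S X a b
    pres-T  : ∀ a b → T Y (fun a) (fun b) ≡ T X a b
open Emb public

module _ {n : ℕ} (R : Fin n → Fin n → Bool) where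

  Adj : Fin n → Fin n → Set
  Adj v w = (R v w ≡ true) ⊎ (R w v ≡ true)

  Cycle : Set
  Cycle = Σ[ k ∈ ℕ ] Σ[ c ∈ (Fin (suc (suc (suc k))) → Fin n) ]
            Injective _≡_ _≡_ c
          × (∀ (i : Fin (suc (suc k))) → Adj (c (inject₁ i)) (c (suc i)))
          × Adj (c (fromℕ (suc (suc k)))) (c zero)

  IsDirectedForest : Set
  IsDirectedForest =
      (∀ v → R v v ≡ false)
    × (∀ v w → R v w ≡ true → R w v ≡ false)
    × ¬ Cycle

InP : Str → Set
InP X =
    IsDirectedForest (λ v w → S X v w ∨ T X v w)
  × (∀ v w → ¬ ((S X v w ≡ true) × (T X v w ≡ true)))
  × (∀ w → (∀ v → (S X v w ∨ T X v w) ≡ true → S X v w ≡ true)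
         ⊎ (∀ v → (S X v w ∨ T X v w) ≡ true → T X v w ≡ true))

CAP : (Str → Set) → Set
CAP F =
  ∀ (Z : Str) → F Z →
    Σ[ Z' ∈ Str ] F Z' × Emb Z Z' ×
      (∀ (X Y : Str) → F X → F Y → (f : Emb Z' X) (g : Emb Z' Y) →
        Σ[ W ∈ Str ] F W × Σ[ f' ∈ Emb X W ] Σ[ g' ∈ Emb Y W ]
          (∀ z → fun f' (fun f z) ≡ fun g' (fun g z)))

module Submission where

-- Every nonempty structure in 𝒫 has a source w: otherwise walking backwards
-- along edges would revisit a vertex and close a directed cycle. Hanging a new
-- vertex above w by an S-edge, resp. a T-edge, gives two structures in 𝒫 over
-- the same base, but in any amalgam the image of w receives both an S-edge and
-- a T-edge, violating (2) or (3). Hence the one-point structure has no cofinal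
-- amalgamation base above it.

open import Defs
open import Data.Bool using (Bool; true; false; _∨_)
import Data.Bool as Bool
open import Data.Bool.Properties using (∨-identityʳ; ∨-zeroʳ; ¬-not; not-¬)
open import Data.Empty using (⊥; ⊥-elim)
open import Data.Fin using (Fin; zero; suc; inject₁; fromℕ; toℕ; fromℕ<; punchOut; _≟_)
open import Data.Fin.Properties
  using (toℕ-inject₁; toℕ-injective; toℕ<n; toℕ-fromℕ; toℕ-fromℕ<; suc-injective;
         punchOut-injective; any?; all?; ¬∀⟶∃¬; pigeonhole)
open import Data.Nat using (ℕ; zero; suc; _+_; _≤_; z≤n; s≤s⁻¹)
open import Data.Nat.GeneralisedArithmetic using (fold)
open import Data.Nat.Properties
  using (+-suc; +-identityʳ; +-cancelˡ-≡; +-monoʳ-≤; m≤n⇒m<n∨m≡n; <⇒≢; n<1+n; m≤n⇒∃[o]m+o≡n)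
open import Data.Product using (Σ-syntax; _×_; _,_; proj₁; proj₂)
open import Data.Sum using (_⊎_; inj₁; inj₂)
import Data.Sum as Sum
open import Function using (_∘_)
open import Function.Definitions using (Injective)
open import Relation.Nullary using (¬_; yes; no; does; contradiction)
open import Relation.Nullary.Decidable using (dec-true)
open import Relation.Binary.PropositionalEquality using (_≡_; _≢_; refl; sym; trans; cong; subst)

module _ {n : ℕ} (s : ℕ → Fin n) where

  InjectiveUpTo : ℕ → Set
  InjectiveUpTo j = ∀ a b → a ≤ j → b ≤ j → s a ≡ s b → a ≡ b

  FirstRepetition : Set
  FirstRepetition = Σ[ i ∈ ℕ ] Σ[ j ∈ ℕ ] i ≤ j × s i ≡ s (suc j) × InjectiveUpTo j

  injectiveUpTo-suc : ∀ {j} → InjectiveUpTo j → (∀ (k : Fin (suc j)) → s (toℕ k) ≢ s (suc j)) →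
                      InjectiveUpTo (suc j)
  injectiveUpTo-suc inj new a b a≤ b≤ eq with m≤n⇒m<n∨m≡n a≤ | m≤n⇒m<n∨m≡n b≤
  ... | inj₁ a< | inj₁ b<     = inj a b (s≤s⁻¹ a<) (s≤s⁻¹ b<) eq
  ... | inj₁ a< | inj₂ refl   = contradiction (trans (cong s (toℕ-fromℕ< a<)) eq) (new (fromℕ< a<))
  ... | inj₂ refl | inj₁ b<   = contradiction (trans (cong s (toℕ-fromℕ< b<)) (sym eq)) (new (fromℕ< b<))
  ... | inj₂ refl | inj₂ refl = refl

  injectiveUpTo⊎firstRepetition : ∀ j → InjectiveUpTo j ⊎ FirstRepetition
  injectiveUpTo⊎firstRepetition zero = inj₁ λ { _ _ z≤n z≤n _ → refl }
  injectiveUpTo⊎firstRepetition (suc j) with injectiveUpTo⊎firstRepetition j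
  ... | inj₂ rep = inj₂ rep
  ... | inj₁ inj with any? (λ (k : Fin (suc j)) → s (toℕ k) ≟ s (suc j))
  ... | yes (k , eq) = inj₂ (toℕ k , j , s≤s⁻¹ (toℕ<n k) , eq , inj)
  ... | no new       = inj₁ (injectiveUpTo-suc inj (λ k eq → new (k , eq)))

  ¬injectiveUpTo-size : ¬ InjectiveUpTo n
  ¬injectiveUpTo-size inj =
    let a , b , a<b , eq = pigeonhole (n<1+n n) (s ∘ toℕ)
    in <⇒≢ a<b (inj _ _ (s≤s⁻¹ (toℕ<n a)) (s≤s⁻¹ (toℕ<n b)) eq)

  firstRepetition : FirstRepetition
  firstRepetition with injectiveUpTo⊎firstRepetition n
  ... | inj₁ inj = contradiction inj ¬injectiveUpTo-size
  ... | inj₂ rep = rep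

module _ {n : ℕ} {R : Fin n → Fin n → Bool} (forest : IsDirectedForest R) where

  ¬directedCycle : ∀ e (c : Fin (suc e) → Fin n) → Injective _≡_ _≡_ c →
                   (∀ k → R (c (suc k)) (c (inject₁ k)) ≡ true) → R (c zero) (c (fromℕ e)) ≡ true → ⊥
  ¬directedCycle zero c _ _ closing = not-¬ (proj₁ forest (c zero)) closing
  ¬directedCycle (suc zero) c _ edge closing = not-¬ (proj₁ (proj₂ forest) _ _ closing) (edge zero)
  ¬directedCycle (suc (suc k)) c inj edge closing =
    proj₂ (proj₂ forest) (k , c , inj , inj₂ ∘ edge , inj₂ closing)

  ¬parentFunction : (parent : Fin n → Fin n) → (∀ v → R (parent v) v ≡ true) → Fin n → ⊥
  ¬parentFunction parent parent-edge v₀ with firstRepetition (fold v₀ parent)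
  ... | i , j , i≤j , return , inj with m≤n⇒∃[o]m+o≡n i≤j
  ... | e , refl = ¬directedCycle e c c-injective c-edge c-closing
    where
      ancestor : ℕ → Fin n
      ancestor = fold v₀ parent

      c : Fin (suc e) → Fin n
      c k = ancestor (i + toℕ k)

      c-injective : Injective _≡_ _≡_ c
      c-injective {x} {y} eq = toℕ-injective (+-cancelˡ-≡ i _ _ (inj _ _ (bound x) (bound y) eq))
        where
          bound : ∀ (x : Fin (suc e)) → i + toℕ x ≤ i + e
          bound x = +-monoʳ-≤ i (s≤s⁻¹ (toℕ<n x))

      c-edge : ∀ k → R (c (suc k)) (c (inject₁ k)) ≡ true
      c-edge k rewrite toℕ-inject₁ k | +-suc i (toℕ k) = parent-edge (ancestor (i + toℕ k))

      c-closing : R (c zero) (c (fromℕ e)) ≡ true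
      c-closing rewrite +-identityʳ i | toℕ-fromℕ e | return = parent-edge (ancestor (i + e))

  source : Fin n → Σ[ w ∈ Fin n ] (∀ v → R v w ≡ false)
  source v₀ with any? (λ w → all? (λ v → R v w Bool.≟ false))
  ... | yes src = src
  ... | no noSource = ⊥-elim (¬parentFunction (proj₁ ∘ hasParent) (¬-not ∘ proj₂ ∘ hasParent) v₀)
    where
      hasParent : ∀ w → Σ[ v ∈ Fin n ] R v w ≢ false
      hasParent w = ¬∀⟶∃¬ n _ (λ v → R v w Bool.≟ false) (λ src → noSource (w , src))

last⊎inject₁ : ∀ {m} (q : Fin (suc m)) → q ≡ fromℕ m ⊎ Σ[ q′ ∈ Fin m ] q ≡ inject₁ q′
last⊎inject₁ {zero} zero = inj₁ refl
last⊎inject₁ {suc m} zero = inj₂ (zero , refl)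
last⊎inject₁ {suc m} (suc q) with last⊎inject₁ q
... | inj₁ refl       = inj₁ refl
... | inj₂ (q′ , refl) = inj₂ (suc q′ , refl)

inject₁²≢suc² : ∀ {m} (q : Fin m) → inject₁ (inject₁ q) ≢ suc (suc q)
inject₁²≢suc² zero ()
inject₁²≢suc² (suc q) eq = inject₁²≢suc² q (suc-injective eq)

module _ {n : ℕ} {R : Fin n → Fin n → Bool} (k : ℕ) (c : Fin (suc (suc (suc k))) → Fin n)
         (edge : ∀ i → Adj R (c (inject₁ i)) (c (suc i)))
         (closing : Adj R (c (fromℕ (suc (suc k)))) (c zero)) where

  cycle-twoNeighbours : ∀ q → Σ[ q₁ ∈ _ ] Σ[ q₂ ∈ _ ] q₁ ≢ q₂ × Adj R (c q) (c q₁) × Adj R (c q) (c q₂)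
  cycle-twoNeighbours zero = suc zero , fromℕ (suc (suc k)) , (λ ()) , edge zero , Sum.swap closing
  cycle-twoNeighbours (suc q) with last⊎inject₁ q
  ... | inj₁ refl       = inject₁ q , zero , (λ ()) , Sum.swap (edge q) , closing
  ... | inj₂ (q′ , refl) = inject₁ q , suc (suc q′) , inject₁²≢suc² q′ , Sum.swap (edge q) , edge (suc q′)

module _ {m : ℕ} {G : Fin (suc m) → Fin (suc m) → Bool} {R : Fin m → Fin m → Bool} {w : Fin m}
         (G-suc : ∀ a b → G (suc a) (suc b) ≡ R a b)
         (G-into-zero : ∀ x → G x zero ≡ false)
         (G-from-zero : ∀ y → G zero (suc y) ≡ true → y ≡ w) where

  adj-zero : ∀ x → Adj G zero x → x ≡ suc w
  adj-zero zero    (inj₁ e) = contradiction e (not-¬ (G-into-zero zero))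
  adj-zero zero    (inj₂ e) = contradiction e (not-¬ (G-into-zero zero))
  adj-zero (suc y) (inj₁ e) = cong suc (G-from-zero y e)
  adj-zero (suc y) (inj₂ e) = contradiction e (not-¬ (G-into-zero (suc y)))

  adj-punchOut : ∀ {x y} (0≢x : zero ≢ x) (0≢y : zero ≢ y) →
                 Adj G x y → Adj R (punchOut 0≢x) (punchOut 0≢y)
  adj-punchOut {zero}  0≢x _ = contradiction refl 0≢x
  adj-punchOut {suc a} {zero} _ 0≢y = contradiction refl 0≢y
  adj-punchOut {suc a} {suc b} _ _ = Sum.map (trans (sym (G-suc a b))) (trans (sym (G-suc b a)))

  -- A cycle cannot pass through the new vertex, whose only neighbour is suc w.
  isDirectedForest-addPendant : IsDirectedForest R → IsDirectedForest G
  isDirectedForest-addPendant (irreflexive , antisymmetric , acyclic) =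
    irreflexive′ , antisymmetric′ , acyclic′
    where
      irreflexive′ : ∀ v → G v v ≡ false
      irreflexive′ zero    = G-into-zero zero
      irreflexive′ (suc a) = trans (G-suc a a) (irreflexive a)

      antisymmetric′ : ∀ v u → G v u ≡ true → G u v ≡ false
      antisymmetric′ v       zero    e = contradiction e (not-¬ (G-into-zero v))
      antisymmetric′ zero    (suc b) _ = G-into-zero (suc b)
      antisymmetric′ (suc a) (suc b) e = trans (G-suc b a) (antisymmetric a b (trans (sym (G-suc a b)) e))

      acyclic′ : ¬ Cycle G
      acyclic′ (k , c , inj , edge , closing) =
        acyclic (k , c′ , c′-injective , (λ i → adj-punchOut _ _ (edge i)) , adj-punchOut _ _ closing)
        where
          avoidsZero : ∀ q → zero ≢ c q
          avoidsZero q 0≡cq with cycle-twoNeighbours {R = G} k c edge closing q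
          ... | q₁ , q₂ , q₁≢q₂ , adj₁ , adj₂ =
            q₁≢q₂ (inj (trans (adj-zero _ (subst (λ v → Adj G v (c q₁)) (sym 0≡cq) adj₁))
                              (sym (adj-zero _ (subst (λ v → Adj G v (c q₂)) (sym 0≡cq) adj₂)))))

          c′ : Fin (suc (suc (suc k))) → Fin m
          c′ q = punchOut (avoidsZero q)

          c′-injective : Injective _≡_ _≡_ c′
          c′-injective {x} {y} = inj ∘ punchOut-injective (avoidsZero x) (avoidsZero y)

discrete : ℕ → Str
discrete n = record { size = n ; S = λ _ _ → false ; T = λ _ _ → false }

InP-discrete : ∀ n → InP (discrete n)
InP-discrete n =
  ((λ _ → refl) , (λ _ _ ()) , λ { (_ , _ , _ , edge , _) → Sum.[ (λ ()) , (λ ()) ] (edge zero) }) ,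
  (λ _ _ ()) , λ _ → inj₁ λ _ ()

addRootRel : ∀ {m} → (Fin m → Fin m → Bool) → (Fin m → Bool) → Fin (suc m) → Fin (suc m) → Bool
addRootRel R out _       zero    = false
addRootRel R out zero    (suc y) = out y
addRootRel R out (suc x) (suc y) = R x y

addRoot : (Z : Str) → (Fin (size Z) → Bool) → (Fin (size Z) → Bool) → Str
addRoot Z σ τ = record { size = suc (size Z) ; S = addRootRel (S Z) σ ; T = addRootRel (T Z) τ }

addRoot-embedding : (Z : Str) (σ τ : Fin (size Z) → Bool) → Emb Z (addRoot Z σ τ)
addRoot-embedding Z σ τ =
  record { fun = suc ; inj = suc-injective ; pres-S = λ _ _ → refl ; pres-T = λ _ _ → refl }

InP-addRoot : (Z : Str) (σ τ : Fin (size Z) → Bool) (w : Fin (size Z)) → InP Z →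
              (∀ v → (S Z v w ∨ T Z v w) ≡ false) →
              (∀ y → (σ y ∨ τ y) ≡ true → y ≡ w) →
              (∀ y → ¬ ((σ y ≡ true) × (τ y ≡ true))) →
              InP (addRoot Z σ τ)
InP-addRoot Z σ τ w (forest , disjoint , monochrome) w-source σ∨τ⇒w στ-disjoint =
  isDirectedForest-addPendant (λ _ _ → refl) (λ _ → refl) σ∨τ⇒w forest , disjoint′ , monochrome′
  where
    S′ T′ : Fin (suc (size Z)) → Fin (suc (size Z)) → Bool
    S′ = addRootRel (S Z) σ
    T′ = addRootRel (T Z) τ

    disjoint′ : ∀ v u → ¬ ((S′ v u ≡ true) × (T′ v u ≡ true))
    disjoint′ _       zero    (() , _)
    disjoint′ zero    (suc y) = στ-disjoint y
    disjoint′ (suc x) (suc y) = disjoint x y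

    monochrome′ : ∀ u → (∀ v → (S′ v u ∨ T′ v u) ≡ true → S′ v u ≡ true)
                       ⊎ (∀ v → (S′ v u ∨ T′ v u) ≡ true → T′ v u ≡ true)
    monochrome′ zero = inj₁ λ _ ()
    monochrome′ (suc y) with y ≟ w
    monochrome′ (suc y) | no y≢w with monochrome y
    ... | inj₁ allS = inj₁ λ { zero e → contradiction (σ∨τ⇒w y e) y≢w ; (suc v) e → allS v e }
    ... | inj₂ allT = inj₂ λ { zero e → contradiction (σ∨τ⇒w y e) y≢w ; (suc v) e → allT v e }
    monochrome′ (suc y) | yes refl with σ y in σy
    ... | true  = inj₁ λ { zero _ → σy
                         ; (suc v) e → contradiction e (not-¬ (w-source v)) }
    ... | false = inj₂ λ { zero e → trans (sym (cong (_∨ τ y) σy)) e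
                         ; (suc v) e → contradiction e (not-¬ (w-source v)) }

singleton : ∀ {m} → Fin m → Fin m → Bool
singleton w y = does (y ≟ w)

singleton-self : ∀ {m} (w : Fin m) → singleton w w ≡ true
singleton-self w = dec-true (w ≟ w) refl

singleton-member : ∀ {m} {w y : Fin m} → singleton w y ≡ true → y ≡ w
singleton-member {w = w} {y} e with y ≟ w
... | yes y≡w = y≡w
... | no _    = contradiction e λ ()

¬InP-S-and-T-parents : ∀ {W : Str} {a b c} → InP W → S W a c ≡ true → T W b c ≡ true → ⊥
¬InP-S-and-T-parents {W} {a} {b} {c} (_ , disjoint , monochrome) Sac Tbc with monochrome c
... | inj₁ allS = disjoint b c (allS b (trans (cong (S W b c ∨_) Tbc) (∨-zeroʳ _)) , Tbc)
... | inj₂ allT = disjoint a c (Sac , allT a (cong (_∨ T W a c) Sac))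

IsAmalgamationBase : (Str → Set) → Str → Set
IsAmalgamationBase F Z =
  ∀ (X Y : Str) → F X → F Y → (f : Emb Z X) (g : Emb Z Y) →
    Σ[ W ∈ Str ] F W × Σ[ f′ ∈ Emb X W ] Σ[ g′ ∈ Emb Y W ] (∀ z → fun f′ (fun f z) ≡ fun g′ (fun g z))

module _ (Z : Str) (Z∈P : InP Z) (w : Fin (size Z)) (w-source : ∀ v → (S Z v w ∨ T Z v w) ≡ false) where

  nowhere : Fin (size Z) → Bool
  nowhere _ = false

  S-parent T-parent : Str
  S-parent = addRoot Z (singleton w) nowhere
  T-parent = addRoot Z nowhere (singleton w)

  InP-S-parent : InP S-parent
  InP-S-parent = InP-addRoot Z (singleton w) nowhere w Z∈P w-source
    (λ y e → singleton-member (trans (sym (∨-identityʳ _)) e)) (λ _ ())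

  InP-T-parent : InP T-parent
  InP-T-parent = InP-addRoot Z nowhere (singleton w) w Z∈P w-source
    (λ _ → singleton-member) (λ _ ())

  ¬IsAmalgamationBase : ¬ IsAmalgamationBase InP Z
  ¬IsAmalgamationBase amalgamate
    with amalgamate S-parent T-parent InP-S-parent InP-T-parent
           (addRoot-embedding Z _ _) (addRoot-embedding Z _ _)
  ... | W , W∈P , f′ , g′ , commutes = ¬InP-S-and-T-parents W∈P S-edge T-edge
    where
      S-edge : S W (fun f′ zero) (fun f′ (suc w)) ≡ true
      S-edge = trans (pres-S f′ zero (suc w)) (singleton-self w)

      T-edge : T W (fun g′ zero) (fun f′ (suc w)) ≡ true
      T-edge rewrite commutes w = trans (pres-T g′ zero (suc w)) (singleton-self w)

mainTheorem4 : ¬ CAP InP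
mainTheorem4 cap =
  let Z , Z∈P , point↪Z , amalgamate = cap (discrete 1) (InP-discrete 1)
      w , w-source = source (proj₁ Z∈P) (fun point↪Z zero)
  in ¬IsAmalgamationBase Z Z∈P w w-source amalgamate
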